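{- Let $M\ge0$, $\mu\in\operatorname{Fil}^M\mathbf{D}_k(\mathbb{Z}_p)$, $b\in\mathbb{Z}_p$, $s\ge1$ and $\beta=\begin{pmatrix}1&b\\0&p^s\end{pmatrix}$. Then for every integer $t$ with $0\le t\le s(k-1)$, $$\mu|_k\beta\in p^{s(k-1)-t}\operatorname{Fil}^{M+t}\mathbf{D}_k(\mathbb{Z}_p).$$ In particular (case $s=t=1$), $\mu|_k\beta\in p^{k-2}\operatorname{Fil}^{M+1}\mathbf{D}_k(\mathbb{Z}_p)$.
   Context: $p$ is a prime, $k\ge2$ an integer. $\mathcal{D}$ is the space of $\mathbb{Q}_p$-linear forms on $\mathbb{Q}_p[z]$, with $\mathcal{C}(\mu)=\sum_{j\ge0}\mu(z^j)w^j$; $\mathbf{D}_k(\mathbb{Z}_p)=\mathcal{C}^{ -1}(\mathbb{Z}_p[[w]])$. For $M\ge0$, $\operatorname{Fil}^M\mathbf{D}_k(\mathbb{Z}_p)$ is the set of $\mu$ with $\mathcal{C}(\mu)\in w^{k-1}\mathbb{Z}_p[[w]]$ and $\mu(z^{k-2+j})\in p^{M-j+1}\mathbb{Z}_p$ for $j=1,\dots,M$; equivalently $\mathcal{C}(\mu)\in p^Mw^{k-1}\mathbb{Z}_p[w/p]+w^{M+k-1}\mathbb{Z}_p[[w]]$. For $\beta=\begin{pmatrix}a&b\\0&d\end{pmatrix}$ the action is $(\mu|_k\beta)(z^n)=\int a^{k-2-n}(b+dz)^n\,d\mu$, so that $\mathcal{C}(\mu|_k\beta)(w)=\frac{1}{1-bw}\mathcal{C}(\mu)\!\left(\frac{p^sw}{1-bw}\right)$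 for $\beta=\begin{pmatrix}1&b\\0&p^s\end{pmatrix}$. -}

module Defs where

open import Data.Nat as ℕ using (ℕ; zero; suc)
open import Data.Nat.Combinatorics using (_C_)
open import Data.Integer as ℤ using (ℤ; +_)
open import Data.Integer.Divisibility.Signed using (_∣_; ∣m∣n⇒∣m+n; ∣n⇒∣m*n; ∣m⇒∣m*n; ∣-refl)
open import Data.Integer.Tactic.RingSolver using (solve-∀)
open import Data.Product using (Σ; ∃; _×_; _,_)
open import Relation.Binary.PropositionalEquality using (_≡_; subst; sym)

-- The p-adic integers ℤ_p, modelled as the inverse limit of ℤ/p^n:
-- a sequence of integers x₀, x₁, … with x_{n+1} ≡ x_n (mod p^n).
-- (x_n represents the class of the element modulo p^n.)
record ℤp (p : ℕ) : Set where
  constructor mkℤp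
  field
    seq : ℕ → ℤ
    coh : ∀ n → (+ (p ℕ.^ n)) ∣ (seq (suc n) ℤ.- seq n)
open ℤp public

module _ {p : ℕ} where

  infix 4 _≈_
  _≈_ : ℤp p → ℤp p → Set
  x ≈ y = ∀ n → (+ (p ℕ.^ n)) ∣ (seq x n ℤ.- seq y n)

  private
    lemAdd : ∀ a b c d → (a ℤ.+ b) ℤ.- (c ℤ.+ d) ≡ (a ℤ.- c) ℤ.+ (b ℤ.- d)
    lemAdd = solve-∀
    lemMul : ∀ a b c d → (a ℤ.* b) ℤ.- (c ℤ.* d) ≡ a ℤ.* (b ℤ.- d) ℤ.+ (a ℤ.- c) ℤ.* d
    lemMul = solve-∀
    lemConst : ∀ a → a ℤ.- a ≡ + 0 ℤ.* a
    lemConst = solve-∀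

  ι : ℤ → ℤp p
  ι a = mkℤp (λ _ → a) (λ n → subst (_ ∣_) (sym (lemConst a)) (∣n⇒∣m*n (+ 0) (Data.Integer.Divisibility.Signed.divides (+ 0) refl0)))
    where
    open import Relation.Binary.PropositionalEquality using () renaming (refl to refl0)

  infixl 6 _+ₚ_
  infixl 7 _*ₚ_
  _+ₚ_ : ℤp p → ℤp p → ℤp p
  x +ₚ y = mkℤp (λ n → seq x n ℤ.+ seq y n)
    (λ n → subst (_ ∣_) (sym (lemAdd (seq x (suc n)) (seq y (suc n)) (seq x n) (seq y n)))
             (∣m∣n⇒∣m+n (coh x n) (coh y n)))

  _*ₚ_ : ℤp p → ℤp p → ℤp p
  x *ₚ y = mkℤp (λ n → seq x n ℤ.* seq y n)
    (λ n → subst (_ ∣_) (sym (lemMul (seq x (suc n)) (seq y (suc n)) (seq x n) (seq y n)))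
             (∣m∣n⇒∣m+n (∣n⇒∣m*n (seq x (suc n)) (coh y n)) (∣m⇒∣m*n (seq y n) (coh x n))))

  0ₚ : ℤp p
  0ₚ = ι (+ 0)

  _^ₚ_ : ℤp p → ℕ → ℤp p
  x ^ₚ zero = ι (+ 1)
  x ^ₚ suc n = x *ₚ (x ^ₚ n)

  sumₚ : ℕ → (ℕ → ℤp p) → ℤp p
  sumₚ zero f = 0ₚ
  sumₚ (suc n) f = sumₚ n f +ₚ f n

  _∣ₚ_ : ℕ → ℤp p → Set
  m ∣ₚ x = ∃ λ (y : ℤp p) → x ≈ ι (+ (p ℕ.^ m)) *ₚ y

-- An element μ of D_k(ℤ_p) is determined by its moments μ(z^j) ∈ ℤ_p (j ≥ 0):
-- 𝒞(μ) = Σ μ(z^j) w^j ∈ ℤ_p[[w]].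
Dk : ℕ → Set
Dk p = ℕ → ℤp p

-- Fil^M D_k(ℤ_p): 𝒞(μ) ∈ w^{k-1} ℤ_p[[w]] and μ(z^{k-2+j}) ∈ p^{M-j+1} ℤ_p for j = 1..M.
Fil : (p k M : ℕ) → Dk p → Set
Fil p k M μ =
  (∀ j → j ℕ.< k ℕ.∸ 1 → μ j ≈ 0ₚ) ×
  (∀ j → 1 ℕ.≤ j → j ℕ.≤ M → (M ℕ.∸ j ℕ.+ 1) ∣ₚ μ (k ℕ.∸ 2 ℕ.+ j))

-- μ |_k β for β = (1 b ; 0 p^s):
-- (μ|β)(z^n) = ∫ (b + p^s z)^n dμ = Σ_{i=0}^{n} C(n,i) b^{n-i} p^{s i} μ(z^i).
actβ : (p : ℕ) → ℤp p → ℕ → Dk p → Dk p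
actβ p b s μ n =
  sumₚ (suc n) (λ i → ι (+ (n C i)) *ₚ (b ^ₚ (n ℕ.∸ i)) *ₚ ι (+ (p ℕ.^ (s ℕ.* i))) *ₚ μ i)

InScaledFil : (p k a M' : ℕ) → Dk p → Set
InScaledFil p k a M' μ =
  Σ (Dk p) λ ν → Fil p k M' ν × (∀ n → μ n ≈ ι (+ (p ℕ.^ a)) *ₚ ν n)

{-# OPTIONS --safe #-}
module Submission where

-- The moments μ(z^i) with i < k − 1 vanish,
-- so the moments of μ|β below k − 1 vanish too. For i = k − 2 + j the i-th term is divisible by
-- p^{si + M − j + 1}; since si ≥ s(k − 1) and i ≤ n, this exponent is at least
-- (s(k − 1) − t) + (M + t − (n − k + 2) + 1), so dividing each moment by p^{s(k−1)−t} leaves a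
-- quotient ν(z^n) meeting the Fil^{M+t} condition on it.

open import Defs
open import Data.Nat using (ℕ; _≤_; _*_; _∸_; _+_)
open import Data.Nat.Primality using (Prime)

open import Data.Nat as ℕ using (zero; suc; s≤s; _<_; _≤?_)
open import Data.Nat.Combinatorics using (_C_)
import Data.Nat.Properties as ℕ
open import Data.Integer as ℤ using (ℤ; +_)
import Data.Integer.Properties as ℤ
open import Data.Integer.Divisibility.Signed using (_∣_; divides; ∣m∣n⇒∣m+n; ∣n⇒∣m*n; ∣m⇒∣m*n; ∣-refl)
open import Data.Integer.Tactic.RingSolver using (solve-∀)
open import Data.Nat.Tactic.RingSolver using () renaming (solve-∀ to ℕ-solve-∀)
open import Data.Product using (Σ; _×_; _,_; proj₁; proj₂)
open import Relation.Binary.PropositionalEquality using (_≡_; refl; subst; subst₂; sym; trans; cong)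
open import Relation.Nullary using (Dec; yes; no)
open import Data.Empty using (⊥-elim)

module _ {p : ℕ} where

  private
    p^ : ℕ → ℤ
    p^ m = + (p ℕ.^ m)

    p^-+ : ∀ m n → p^ (m + n) ≡ p^ m ℤ.* p^ n
    p^-+ m n = trans (cong +_ (ℕ.^-distribˡ-+-* p m n)) (ℤ.pos-* (p ℕ.^ m) (p ℕ.^ n))

  ≡⇒∣- : ∀ {d} a {b} → a ≡ b → d ∣ (a ℤ.- b)
  ≡⇒∣- {d} a refl = subst (d ∣_) (sym (ℤ.+-inverseʳ a)) (divides (+ 0) (sym (ℤ.*-zeroˡ d)))

  ≈-refl : {x : ℤp p} → x ≈ x
  ≈-refl {x} n = ≡⇒∣- (seq x n) refl

  0∣ₚ : ∀ (x : ℤp p) → 0 ∣ₚ x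
  0∣ₚ x = x , λ n → ≡⇒∣- (seq x n) (sym (ℤ.*-identityˡ (seq x n)))

  ∣ₚ-ι-pow : ∀ m → m ∣ₚ ι {p} (p^ m)
  ∣ₚ-ι-pow m = ι (+ 1) , λ n → ≡⇒∣- (p^ m) (sym (ℤ.*-identityʳ (p^ m)))

  ∣ₚ-pow-* : ∀ m (y : ℤp p) → m ∣ₚ (ι (p^ m) *ₚ y)
  ∣ₚ-pow-* m y = y , ≈-refl {x = ι (p^ m) *ₚ y}

  ≈0⇒∣ₚ : ∀ {m} (x : ℤp p) → x ≈ 0ₚ → m ∣ₚ x
  ≈0⇒∣ₚ {m} x x≈0 = 0ₚ , λ r → subst (λ z → p^ r ∣ (seq x r ℤ.- z)) (sym (ℤ.*-zeroʳ (p^ m))) (x≈0 r)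

  ∣ₚ-+ : ∀ {m} (x y : ℤp p) → m ∣ₚ x → m ∣ₚ y → m ∣ₚ (x +ₚ y)
  ∣ₚ-+ {m} x y (u , x≈) (v , y≈) = u +ₚ v , λ n →
    subst (_ ∣_) (sym (split (seq x n) (seq y n) (p^ m) (seq u n) (seq v n)))
      (∣m∣n⇒∣m+n (x≈ n) (y≈ n))
    where
    split : ∀ x y A u v → (x ℤ.+ y) ℤ.- A ℤ.* (u ℤ.+ v) ≡ (x ℤ.- A ℤ.* u) ℤ.+ (y ℤ.- A ℤ.* v)
    split = solve-∀

  ∣ₚ-* : ∀ {m n} (x y : ℤp p) → m ∣ₚ x → n ∣ₚ y → (m + n) ∣ₚ (x *ₚ y)
  ∣ₚ-* {m} {n} x y (u , x≈) (v , y≈) = u *ₚ v , λ r →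
    subst (_ ∣_)
      (sym (trans (cong (λ P → seq x r ℤ.* seq y r ℤ.- P ℤ.* (seq u r ℤ.* seq v r)) (p^-+ m n))
                  (split (seq x r) (seq y r) (p^ m) (p^ n) (seq u r) (seq v r))))
      (∣m∣n⇒∣m+n (∣n⇒∣m*n (seq x r) (y≈ r)) (∣n⇒∣m*n (p^ n ℤ.* seq v r) (x≈ r)))
    where
    split : ∀ x y A B u v → x ℤ.* y ℤ.- (A ℤ.* B) ℤ.* (u ℤ.* v)
                          ≡ x ℤ.* (y ℤ.- B ℤ.* v) ℤ.+ (B ℤ.* v) ℤ.* (x ℤ.- A ℤ.* u)
    split = solve-∀

  ∣ₚ-*ˡ : ∀ {n} (x y : ℤp p) → n ∣ₚ y → n ∣ₚ (x *ₚ y)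
  ∣ₚ-*ˡ {n} x y = ∣ₚ-* {0} {n} x y (0∣ₚ x)

  ∣ₚ-sum : ∀ {m} n (f : ℕ → ℤp p) → (∀ i → i < n → m ∣ₚ f i) → m ∣ₚ sumₚ n f
  ∣ₚ-sum {m} zero    f _   = ≈0⇒∣ₚ {m} 0ₚ (≈-refl {x = 0ₚ})
  ∣ₚ-sum {m} (suc n) f f∣ = ∣ₚ-+ {m} (sumₚ n f) (f n)
    (∣ₚ-sum {m} n f (λ i i<n → f∣ i (ℕ.m<n⇒m<1+n i<n))) (f∣ n (ℕ.n<1+n n))

  ∣ₚ-weaken : ∀ {d e} (x : ℤp p) → d ≤ e → e ∣ₚ x → d ∣ₚ x
  ∣ₚ-weaken {d} {e} x d≤e (y , x≈) = ι (p^ (e ∸ d)) *ₚ y , λ r →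
    subst (λ z → p^ r ∣ (seq x r ℤ.- z))
      (trans (cong (λ w → p^ w ℤ.* seq y r) (sym (ℕ.m+[n∸m]≡n d≤e)))
             (trans (cong (ℤ._* seq y r) (p^-+ d (e ∸ d))) (ℤ.*-assoc (p^ d) (p^ (e ∸ d)) (seq y r))))
      (x≈ r)

  ∣ₚ-+-split : ∀ a c (x : ℤp p) → (a + c) ∣ₚ x → Σ (ℤp p) λ z → c ∣ₚ z × x ≈ ι (p^ a) *ₚ z
  ∣ₚ-+-split a c x (y , x≈) = ι (p^ c) *ₚ y , ∣ₚ-pow-* c y , λ r →
    subst (λ z → p^ r ∣ (seq x r ℤ.- z))
      (trans (cong (ℤ._* seq y r) (p^-+ a c)) (ℤ.*-assoc (p^ a) (p^ c) (seq y r)))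
      (x≈ r)

  ∣ₚ-all⇒≈0 : ∀ (x : ℤp p) → (∀ m → m ∣ₚ x) → x ≈ 0ₚ
  ∣ₚ-all⇒≈0 x ∣x r with ∣x r
  ... | y , x≈ = subst (_ ∣_) (sym (split (seq x r) (p^ r) (seq y r)))
                   (∣m∣n⇒∣m+n (x≈ r) (∣m⇒∣m*n (seq y r) ∣-refl))
    where
    split : ∀ x A y → x ℤ.- + 0 ≡ (x ℤ.- A ℤ.* y) ℤ.+ A ℤ.* y
    split = solve-∀

  actβ-∣ₚ : ∀ (b : ℤp p) s (μ : Dk p) m n →
    (∀ i → i ≤ n → (m ∸ s * i) ∣ₚ μ i) → m ∣ₚ actβ p b s μ n
  actβ-∣ₚ b s μ m n μ∣ = ∣ₚ-sum {m} (suc n) term λ i i≤n →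
    ∣ₚ-weaken (term i) (ℕ.m≤n+m∸n m (s * i))
      (∣ₚ-* {s * i} {m ∸ s * i} (coefficient i *ₚ ι (p^ (s * i))) (μ i)
        (∣ₚ-*ˡ {s * i} (coefficient i) (ι (p^ (s * i))) (∣ₚ-ι-pow (s * i)))
        (μ∣ i (ℕ.≤-pred i≤n)))
    where
    coefficient : ℕ → ℤp p
    coefficient i = ι (+ (n C i)) *ₚ (b ^ₚ (n ∸ i))
    term : ℕ → ℤp p
    term i = coefficient i *ₚ ι (p^ (s * i)) *ₚ μ i

  Fil⇒moment-∣ₚ : ∀ {K M} (μ : Dk p) → Fil p (suc (suc K)) M μ →
    ∀ i → K < i → ((M + 1) ∸ (i ∸ K)) ∣ₚ μ i
  Fil⇒moment-∣ₚ {K} {M} μ (_ , μ∣) i K<i with i ∸ K ≤? M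
  ... | yes j≤M = subst₂ (λ e x → e ∣ₚ μ x) (sym (ℕ.+-∸-comm 1 j≤M)) (ℕ.m+[n∸m]≡n (ℕ.<⇒≤ K<i))
                    (μ∣ (i ∸ K) (ℕ.m<n⇒0<n∸m K<i) j≤M)
  ... | no j≰M  = subst (_∣ₚ μ i) (sym (ℕ.m≤n⇒m∸n≡0 (subst (_≤ i ∸ K) (ℕ.+-comm 1 M) (ℕ.≰⇒> j≰M))))
                    (0∣ₚ (μ i))

exponent-bound : ∀ {K M s t i n} → t ≤ s * suc K → K < i → i ≤ n →
  (s * suc K ∸ t) + ((M + t + 1) ∸ (n ∸ K)) ≤ s * i + ((M + 1) ∸ (i ∸ K))
exponent-bound {K} {M} {s} {t} {i} {n} t≤ K<i i≤n = begin
    a + ((M + t + 1) ∸ (n ∸ K))  ≤⟨ ℕ.+-monoʳ-≤ a (ℕ.∸-monoʳ-≤ (M + t + 1) (ℕ.∸-monoˡ-≤ K i≤n)) ⟩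
    a + ((M + t + 1) ∸ j)        ≡⟨ cong (λ x → a + (x ∸ j)) (+-right-comm M t 1) ⟩
    a + ((M + 1 + t) ∸ j)        ≤⟨ ℕ.+-monoʳ-≤ a (∸-+-≤ (M + 1) t j) ⟩
    a + (e + t)                  ≡⟨ cong (λ x → a + x) (ℕ.+-comm e t) ⟩
    a + (t + e)                  ≡⟨ sym (ℕ.+-assoc a t e) ⟩
    a + t + e                    ≡⟨ cong (_+ e) (ℕ.m∸n+n≡m t≤) ⟩
    s * suc K + e                ≤⟨ ℕ.+-monoˡ-≤ e (ℕ.*-monoʳ-≤ s K<i) ⟩
    s * i + e                    ∎
  where
  open ℕ.≤-Reasoning
  a = s * suc K ∸ t
  j = i ∸ K
  e = (M + 1) ∸ j
  +-right-comm : ∀ x y z → x + y + z ≡ x + z + y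
  +-right-comm = ℕ-solve-∀
  ∸-+-≤ : ∀ x t j → (x + t) ∸ j ≤ (x ∸ j) + t
  ∸-+-≤ x t j = ℕ.m≤n+o⇒m∸n≤o (x + t) j
    (subst (x + t ≤_) (ℕ.+-assoc j (x ∸ j) t) (ℕ.+-monoˡ-≤ t (ℕ.m≤n+m∸n x j)))

module Quotient {p K M : ℕ} (μ : Dk p) (μ∈Fil : Fil p (suc (suc K)) M μ)
                    (b : ℤp p) (s : ℕ) {t : ℕ} (t≤ : t ≤ s * suc K) where

  a : ℕ
  a = s * suc K ∸ t

  -- the exponent that Fil^{M+t} demands of the moment z^n, namely M + t − j + 1 at n = k − 2 + j
  c : ℕ → ℕ
  c n = (M + t + 1) ∸ (n ∸ K)

  action-∣ₚ : ∀ n → (a + c n) ∣ₚ actβ p b s μ n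
  action-∣ₚ n = actβ-∣ₚ b s μ (a + c n) n moment-∣ₚ
    where
    moment-∣ₚ : ∀ i → i ≤ n → (a + c n ∸ s * i) ∣ₚ μ i
    moment-∣ₚ i i≤n with i ≤? K
    ... | yes i≤K = ≈0⇒∣ₚ {m = a + c n ∸ s * i} (μ i) (proj₁ μ∈Fil i (s≤s i≤K))
    ... | no  i≰K = ∣ₚ-weaken (μ i)
                      (ℕ.m≤n+o⇒m∸n≤o (a + c n) (s * i) (exponent-bound {M = M} {s = s} t≤ K<i i≤n))
                      (Fil⇒moment-∣ₚ μ μ∈Fil i K<i)
      where K<i = ℕ.≰⇒> i≰K

  action-low : ∀ n → n ≤ K → actβ p b s μ n ≈ 0ₚ
  action-low n n≤K = ∣ₚ-all⇒≈0 (actβ p b s μ n) λ m → actβ-∣ₚ b s μ m n λ i i≤n →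
    ≈0⇒∣ₚ {m = m ∸ s * i} (μ i) (proj₁ μ∈Fil i (s≤s (ℕ.≤-trans i≤n n≤K)))

  quotient : ∀ n → Σ (ℤp p) λ z → c n ∣ₚ z × actβ p b s μ n ≈ ι (+ (p ℕ.^ a)) *ₚ z
  quotient n = ∣ₚ-+-split a (c n) (actβ p b s μ n) (action-∣ₚ n)

  -- Quotients are not unique; below k − 1 the zero quotient is chosen so that ν keeps the
  -- vanishing moments.
  ν-by-cases : ∀ n → Dec (n ≤ K) → ℤp p
  ν-by-cases n (yes _) = 0ₚ
  ν-by-cases n (no _)  = proj₁ (quotient n)

  ν : Dk p
  ν n = ν-by-cases n (n ≤? K)

  action≈ : ∀ n → actβ p b s μ n ≈ ι (+ (p ℕ.^ a)) *ₚ ν n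
  action≈ n = by-cases (n ≤? K)
    where
    by-cases : (d : Dec (n ≤ K)) → actβ p b s μ n ≈ ι (+ (p ℕ.^ a)) *ₚ ν-by-cases n d
    by-cases (yes n≤K) = proj₂ (≈0⇒∣ₚ {m = a} (actβ p b s μ n) (action-low n n≤K))
    by-cases (no _)    = proj₂ (proj₂ (quotient n))

  ν∈Fil : Fil p (suc (suc K)) (M + t) ν
  ν∈Fil = (λ j j<1+K → ν-low j (ℕ.≤-pred j<1+K) (j ≤? K))
        , (λ J 1≤J J≤ → ν-high J 1≤J J≤ (K + J ≤? K))
    where
    ν-low : ∀ j → j ≤ K → (d : Dec (j ≤ K)) → ν-by-cases j d ≈ 0ₚ
    ν-low j _   (yes _)   = ≈-refl {x = 0ₚ}
    ν-low j j≤K (no j≰K) = ⊥-elim (j≰K j≤K)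
    ν-high : ∀ J → 1 ≤ J → J ≤ M + t → (d : Dec (K + J ≤ K)) →
             (M + t ∸ J + 1) ∣ₚ ν-by-cases (K + J) d
    ν-high J 1≤J _  (yes K+J≤K) = ⊥-elim (ℕ.<⇒≱ (ℕ.m<m+n K 1≤J) K+J≤K)
    ν-high J _   J≤ (no _)      =
      subst (_∣ₚ proj₁ (quotient (K + J))) c≡ (proj₁ (proj₂ (quotient (K + J))))
      where
      c≡ : c (K + J) ≡ M + t ∸ J + 1
      c≡ = trans (cong (M + t + 1 ∸_) (ℕ.m+n∸m≡n K J)) (ℕ.+-∸-comm 1 J≤)

mainTheorem6 : (p k : ℕ) → Prime p → 2 ≤ k →
    (M : ℕ) (μ : Dk p) → Fil p k M μ →
    (b : ℤp p) (s : ℕ) → 1 ≤ s →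
    (t : ℕ) → t ≤ s * (k ∸ 1) →
    InScaledFil p k (s * (k ∸ 1) ∸ t) (M + t) (actβ p b s μ)
mainTheorem6 p (suc (suc K)) _ (s≤s (s≤s _)) M μ μ∈Fil b s _ t t≤ = ν , ν∈Fil , action≈
  where open Quotient μ μ∈Fil b s t≤
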